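{- Let $V$ be a finite set and let $\sigma=(\mathcal O,R,f)$ and $\tau=(\mathcal P,Q,g)$ be two skeletons over $V$ such that $G_\sigma=G_\tau$. Then $\sigma$ and $\tau$ are companions.
   Context: A skeleton over a finite set $V$ is a triple $\sigma=(\mathcal O,R,f)$ where $R\subseteq V$, $\mathcal O=\{O_z\mid z\in R\}$ is a family of subsets of $V$ indexed by $R$ with $O_z=O_{z'}$ iff $z=z'$ and $|\mathcal O|\le|V|$, and $f:V\to R$ is a surjection. The graph defined by $\sigma$ is the directed graph $G_\sigma=(V,E)$ with $E=\{(x,w)\mid x\in V,\ w\in O_{f(x)}\}$. For a family $\mathcal O$, $\mathcal O^\cap$ is the smallest family containing $\mathcal O$ and closed under intersection of two sets. A faithful correspondence between $\mathcal O\subseteq 2^V$ and $\mathcal P\subseteq 2^W$ is a bijection $\eta:\mathcal O^\cap\to\mathcal P^\cap$ with $|X|=|\eta(X)|$ and $\eta(X\cap Y)=\eta(X)\cap\eta(Y)$ for all $X,Y\in\mathcal O^\cap$. Two skeletons $\sigma=(\mathcal O,R,f)$ over $V$ and $\tau=(\mathcal P,Q,g)$ over $W$ are companions if there is a bijection $\eta:V\to W$ whose elementwise extension to subsets restricts to a faithful correspondence $\eta:\mathcal O^\cap\to\mathcal P^\cap$ and satisfies $\eta(O_{f(x)})=P_{g(\eta(x))}$ for all $x\in V$. -}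

module Defs where

open import Data.Nat using (ℕ; zero; suc)
open import Data.Bool using (Bool; true; false; _∧_; _∨_)
open import Data.Fin using (Fin; zero; suc)
open import Data.Fin.Subset using (Subset; _∈_; _∩_; ∣_∣)
open import Data.Fin.Properties using (_≟_)
open import Data.Vec using (lookup; tabulate)
open import Data.Product using (Σ; _×_; ∃)
open import Relation.Nullary.Decidable using (⌊_⌋)
open import Relation.Binary.PropositionalEquality using (_≡_)
open import Function.Definitions using (Bijective)
open import Function.Bundles using (_⇔_)

-- A skeleton σ = (𝒪, R, f) over Fin n:
--   R ⊆ V as a Subset; O z is the set O_z (only meaningful for z ∈ R);
--   z ↦ O_z injective on R (so |𝒪| = |R| ≤ |V| automatically);
--   f : V → R a surjection.
record Skeleton (n : ℕ) : Set where
  field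
    R      : Subset n
    O      : Fin n → Subset n
    f      : Fin n → Fin n
    O-inj  : ∀ z z′ → z ∈ R → z′ ∈ R → O z ≡ O z′ → z ≡ z′
    f-into : ∀ x → f x ∈ R
    f-onto : ∀ z → z ∈ R → ∃ λ x → f x ≡ z

open Skeleton public

Edge : ∀ {n} → Skeleton n → Fin n → Fin n → Set
Edge σ x w = w ∈ O σ (f σ x)

SameGraph : ∀ {n} → Skeleton n → Skeleton n → Set
SameGraph σ τ = ∀ x w → Edge σ x w ⇔ Edge τ x w

InFamily : ∀ {n} → Skeleton n → Subset n → Set
InFamily σ X = Σ _ λ z → z ∈ R σ × O σ z ≡ X

data Closure∩ {n : ℕ} (F : Subset n → Set) : Subset n → Set where
  base : ∀ {X} → F X → Closure∩ F X
  meet : ∀ {X Y} → Closure∩ F X → Closure∩ F Y → Closure∩ F (X ∩ Y)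

Closure : ∀ {n} → Skeleton n → Subset n → Set
Closure σ = Closure∩ (InFamily σ)

anyᶠ : ∀ {n} → (Fin n → Bool) → Bool
anyᶠ {zero}  p = false
anyᶠ {suc n} p = p zero ∨ anyᶠ (λ i → p (suc i))

image : ∀ {n} → (Fin n → Fin n) → Subset n → Subset n
image η X = tabulate λ w → anyᶠ λ x → lookup X x ∧ ⌊ η x ≟ w ⌋

FaithfulCorrespondence : ∀ {n} → (Fin n → Fin n) → Skeleton n → Skeleton n → Set
FaithfulCorrespondence η σ τ =
    (∀ X → Closure σ X → Closure τ (image η X))
  × (∀ X Y → Closure σ X → Closure σ Y → image η X ≡ image η Y → X ≡ Y)
  × (∀ Y → Closure τ Y → Σ _ λ X → Closure σ X × image η X ≡ Y)
  × (∀ X → Closure σ X → ∣ X ∣ ≡ ∣ image η X ∣)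
  × (∀ X Y → Closure σ X → Closure σ Y → image η (X ∩ Y) ≡ image η X ∩ image η Y)

Companions : ∀ {n} → Skeleton n → Skeleton n → Set
Companions σ τ =
  Σ (Fin _ → Fin _) λ η →
      Bijective _≡_ _≡_ η
    × FaithfulCorrespondence η σ τ
    × (∀ x → image η (O σ (f σ x)) ≡ O τ (f τ (η x)))

module Submission where

-- Equal graphs mean every vertex x has the same out-neighbourhood in both,
-- i.e. O_{f(x)} = P_{g(x)}.  Since f and g are onto R and Q, the families
-- 𝒪 = {O_{f(x)}} and 𝒫 = {P_{g(x)}} coincide, hence so do their
-- intersection closures.  The identity therefore maps 𝒪^∩ onto 𝒫^∩, and
-- every faithfulness condition becomes trivial once we know that the
-- elementwise image of a set under the identity is the set itself.

open import Defs
open import Data.Nat using (ℕ; zero; suc)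
open import Data.Bool using (Bool; false; _∧_; _∨_)
open import Data.Bool.Properties using (∧-zeroʳ; ∧-identityʳ; ∨-identityʳ)
open import Data.Fin using (Fin; zero; suc)
open import Data.Fin.Subset using (Subset; _∩_; ∣_∣)
open import Data.Fin.Subset.Properties using (⊆-antisym)
open import Data.Fin.Properties using (_≟_)
open import Data.Vec using (lookup)
open import Data.Vec.Properties using (tabulate∘lookup; tabulate-cong)
open import Data.Product using (_,_)
open import Function.Base using (id)
open import Function.Bundles using (Equivalence)
open import Function.Construct.Identity using (bijective)
open import Relation.Nullary.Decidable using (⌊_⌋; yes; no)
open import Relation.Binary.PropositionalEquality
  using (_≡_; refl; sym; trans; cong; cong₂; subst; module ≡-Reasoning)

anyᶠ-cong : ∀ {n} {p q : Fin n → Bool} → (∀ i → p i ≡ q i) → anyᶠ p ≡ anyᶠ q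
anyᶠ-cong {zero}  e = refl
anyᶠ-cong {suc n} e = cong₂ _∨_ (e zero) (anyᶠ-cong (λ i → e (suc i)))

anyᶠ-false : ∀ n → anyᶠ {n} (λ _ → false) ≡ false
anyᶠ-false zero    = refl
anyᶠ-false (suc n) = anyᶠ-false n

suc-≟ : ∀ {n} (i w : Fin n) → ⌊ suc i ≟ suc w ⌋ ≡ ⌊ i ≟ w ⌋
suc-≟ i w with i ≟ w
... | yes _ = refl
... | no  _ = refl

anyᶠ-point : ∀ {n} (p : Fin n → Bool) (w : Fin n) →
             anyᶠ (λ x → p x ∧ ⌊ x ≟ w ⌋) ≡ p w
anyᶠ-point {suc n} p zero = begin
  (p zero ∧ ⌊ zero {n} ≟ zero ⌋) ∨ anyᶠ (λ i → p (suc i) ∧ false)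
    ≡⟨ cong₂ _∨_ (∧-identityʳ (p zero))
                 (trans (anyᶠ-cong (λ i → ∧-zeroʳ (p (suc i)))) (anyᶠ-false n)) ⟩
  p zero ∨ false
    ≡⟨ ∨-identityʳ (p zero) ⟩
  p zero ∎
  where open ≡-Reasoning
anyᶠ-point {suc n} p (suc w) = begin
  (p zero ∧ false) ∨ anyᶠ (λ i → p (suc i) ∧ ⌊ suc i ≟ suc w ⌋)
    ≡⟨ cong₂ _∨_ (∧-zeroʳ (p zero))
                 (anyᶠ-cong (λ i → cong (p (suc i) ∧_) (suc-≟ i w))) ⟩
  false ∨ anyᶠ (λ i → p (suc i) ∧ ⌊ i ≟ w ⌋)
    ≡⟨ anyᶠ-point (λ i → p (suc i)) w ⟩
  p (suc w) ∎
  where open ≡-Reasoning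

image-id : ∀ {n} (X : Subset n) → image id X ≡ X
image-id X = trans (tabulate-cong (anyᶠ-point (lookup X))) (tabulate∘lookup X)

Closure∩-mono : ∀ {n} {F G : Subset n → Set} →
                (∀ {X} → F X → G X) → ∀ {X} → Closure∩ F X → Closure∩ G X
Closure∩-mono F⊆G (base p)   = base (F⊆G p)
Closure∩-mono F⊆G (meet a b) = meet (Closure∩-mono F⊆G a) (Closure∩-mono F⊆G b)

SameNeighbourhoods : ∀ {n} → Skeleton n → Skeleton n → Set
SameNeighbourhoods σ τ = ∀ x → O σ (f σ x) ≡ O τ (f τ x)

sameGraph⇒sameNeighbourhoods : ∀ {n} (σ τ : Skeleton n) →
                               SameGraph σ τ → SameNeighbourhoods σ τ
sameGraph⇒sameNeighbourhoods σ τ sg x =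
  ⊆-antisym (Equivalence.to (sg x _)) (Equivalence.from (sg x _))

-- Every member O_z of 𝒪 is some O_{f(x)} by surjectivity of f, hence lies in 𝒫.
family-⊆ : ∀ {n} (σ τ : Skeleton n) → SameNeighbourhoods σ τ →
           ∀ {X} → InFamily σ X → InFamily τ X
family-⊆ σ τ same (z , z∈R , Oz≡X) with f-onto σ z z∈R
... | x , refl = f τ x , f-into τ x , trans (sym (same x)) Oz≡X

closure-⊆ : ∀ {n} (σ τ : Skeleton n) → SameNeighbourhoods σ τ →
            ∀ {X} → Closure σ X → Closure τ X
closure-⊆ σ τ same = Closure∩-mono (family-⊆ σ τ same)

identity-faithful : ∀ {n} (σ τ : Skeleton n) → SameNeighbourhoods σ τ →
                    FaithfulCorrespondence id σ τ
identity-faithful σ τ same =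
    (λ X c → subst (Closure τ) (sym (image-id X)) (closure-⊆ σ τ same c))
  , (λ X Y _ _ e → trans (sym (image-id X)) (trans e (image-id Y)))
  , (λ Y c → Y , closure-⊆ τ σ (λ x → sym (same x)) c , image-id Y)
  , (λ X _ → cong ∣_∣ (sym (image-id X)))
  , (λ X Y _ _ → trans (image-id (X ∩ Y)) (sym (cong₂ _∩_ (image-id X) (image-id Y))))

sameNeighbourhoods⇒companions : ∀ {n} (σ τ : Skeleton n) →
                                SameNeighbourhoods σ τ → Companions σ τ
sameNeighbourhoods⇒companions σ τ same =
    id
  , bijective _≡_
  , identity-faithful σ τ same
  , (λ x → trans (image-id (O σ (f σ x))) (same x))

lemma3p6 : (n : ℕ) (σ τ : Skeleton n) → SameGraph σ τ → Companions σ τ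
lemma3p6 n σ τ sg = sameNeighbourhoods⇒companions σ τ (sameGraph⇒sameNeighbourhoods σ τ sg)
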